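{- Let $G_1 \in ER(n_1,d_1,\lambda_1)$ have a uniform shared neighborhood structure isomorphic to $H_1$, and let $G_2 \in ER(n_2,d_2,\lambda_2)$ have a uniform shared neighborhood structure isomorphic to $H_2$. Then $G_1\otimes G_2 \in ER(n_1n_2,d_1d_2,\lambda_1\lambda_2)$ and $G_1\otimes G_2$ has a uniform shared neighborhood structure isomorphic to $H_1\otimes H_2$.
   Context: For a finite simple graph $G$, $N(u)$ is the open neighborhood of $u$. $G \in ER(n,d,\lambda)$ means $G$ has $n$ vertices, is $d$-regular, and every pair of adjacent vertices has exactly $\lambda$ common neighbors. $G$ has a uniform shared neighborhood structure isomorphic to $H$ if the induced subgraph $G[N(u)\cap N(v)]$ is isomorphic to $H$ for all adjacent $u,v$. The tensor product $G_1\otimes G_2$ has vertex set $V(G_1)\times V(G_2)$, with $(u,u')\sim(v,v')$ iff $u\sim v$ in $G_1$ and $u'\sim v'$ in $G_2$. -}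

module Defs where

open import Data.Nat using (ℕ; _+_; _*_)
open import Data.Bool using (Bool; true; false; _∧_)
open import Data.Bool.Properties using (∧-comm)
open import Data.Fin using (Fin; remQuot)
open import Data.List using (List; map; allFin)
open import Data.Nat.ListAction using (sum)
open import Data.Product using (Σ; _×_; _,_; ∃; proj₁; proj₂)
open import Function.Definitions using (Injective)
open import Relation.Binary.PropositionalEquality using (_≡_; refl; cong₂)
open import Function.Bundles using (_⇔_)

record Graph (n : ℕ) : Set where
  field
    adj   : Fin n → Fin n → Bool
    sym   : ∀ u v → adj u v ≡ adj v u
    irrefl : ∀ v → adj v v ≡ false
open Graph public

_~_within_ : ∀ {n} → Fin n → Fin n → Graph n → Set
u ~ v within G = adj G u v ≡ true

count : ∀ n → (Fin n → Bool) → ℕ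
count n p = sum (map (λ w → toℕ (p w)) (allFin n))
  where
    toℕ : Bool → ℕ
    toℕ true = 1
    toℕ false = 0

degree : ∀ {n} → Graph n → Fin n → ℕ
degree {n} G u = count n (λ w → adj G u w)

commonCount : ∀ {n} → Graph n → Fin n → Fin n → ℕ
commonCount {n} G u v = count n (λ w → adj G u w ∧ adj G v w)

ER : (n d l : ℕ) → Graph n → Set
ER n d l G =
  (∀ u → degree G u ≡ d) ×
  (∀ u v → u ~ v within G → commonCount G u v ≡ l)

-- The induced subgraph G[N(u) ∩ N(v)] is isomorphic to H:
-- a bijection f from V(H) onto N(u) ∩ N(v) (injective, image exactly N(u) ∩ N(v))
-- with adjacency in H equal to adjacency in G between the images.
InducedCommonIso : ∀ {n m} → Graph n → Fin n → Fin n → Graph m → Set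
InducedCommonIso {n} {m} G u v H =
  Σ (Fin m → Fin n) λ f →
    Injective _≡_ _≡_ f ×
    (∀ w → (adj G u w ∧ adj G v w ≡ true) ⇔ (∃ λ i → f i ≡ w)) ×
    (∀ i j → adj H i j ≡ adj G (f i) (f j))

UniformSNS : ∀ {n m} → Graph n → Graph m → Set
UniformSNS G H = ∀ u v → u ~ v within G → InducedCommonIso G u v H

-- Tensor product; the vertex set V(G₁) × V(G₂) is encoded as Fin (n₁ * n₂)
-- via the standard bijection remQuot (inverse of Data.Fin.combine).
fst : ∀ n₁ n₂ → Fin (n₁ * n₂) → Fin n₁
fst n₁ n₂ x = proj₁ (remQuot {n₁} n₂ x)

snd : ∀ n₁ n₂ → Fin (n₁ * n₂) → Fin n₂
snd n₁ n₂ x = proj₂ (remQuot {n₁} n₂ x)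

tensorAdj : ∀ {n₁ n₂} → Graph n₁ → Graph n₂ → Fin (n₁ * n₂) → Fin (n₁ * n₂) → Bool
tensorAdj {n₁} {n₂} G₁ G₂ x y =
  adj G₁ (fst n₁ n₂ x) (fst n₁ n₂ y) ∧ adj G₂ (snd n₁ n₂ x) (snd n₁ n₂ y)

_⊗_ : ∀ {n₁ n₂} → Graph n₁ → Graph n₂ → Graph (n₁ * n₂)
_⊗_ {n₁} {n₂} G₁ G₂ = record
  { adj = tensorAdj G₁ G₂
  ; sym = λ x y → cong₂ _∧_
      (Graph.sym G₁ (fst n₁ n₂ x) (fst n₁ n₂ y))
      (Graph.sym G₂ (snd n₁ n₂ x) (snd n₁ n₂ y))
  ; irrefl = λ x → irr (fst n₁ n₂ x) (adj G₂ (snd n₁ n₂ x) (snd n₁ n₂ x))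
  }
  where
    irr : ∀ a b → adj G₁ a a ∧ b ≡ false
    irr a b rewrite Graph.irrefl G₁ a = refl

{-# OPTIONS --safe #-}
module Submission where

-- Adjacency in G₁ ⊗ G₂ is the conjunction of adjacency in the two factors, so the
-- common neighbourhood of two adjacent pairs is the product of the common
-- neighbourhoods of their coordinates. Counting a product of predicates over
-- Fin (n₁ * n₂) factors as a double sum, which gives the parameters d₁ d₂ and l₁ l₂,
-- and pairing the isomorphisms Hₖ ≅ Gₖ[N(uₖ) ∩ N(vₖ)] coordinatewise gives
-- H₁ ⊗ H₂ ≅ (G₁ ⊗ G₂)[N(u) ∩ N(v)].

open import Defs hiding (sym)
open import Algebra.Bundles using (CommutativeMonoid)
open import Data.Bool using (Bool; true; false; _∧_)
open import Data.Bool.Properties using (∧-commutativeMonoid)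
open import Algebra.Properties.CommutativeSemigroup
  (CommutativeMonoid.commutativeSemigroup ∧-commutativeMonoid) using (interchange)
open import Data.Fin using (Fin; zero; suc; remQuot; combine; _↑ˡ_; _↑ʳ_)
open import Data.Fin.Properties using (remQuot-combine; combine-remQuot; combine-injective; splitAt-↑ʳ)
import Data.List as List using (tabulate; map; allFin)
open import Data.List.Properties using (map-tabulate)
import Data.Nat.ListAction as List using (sum)
open import Data.Nat using (ℕ; zero; suc; _+_; _*_)
open import Data.Nat.Properties using (+-assoc; +-*-semiring)
open import Algebra.Properties.Semiring.Sum +-*-semiring
  using (sum; sum-cong-≗; *-distribˡ-sum; *-distribʳ-sum; sum-syntax)
open import Data.Product using (_×_; _,_; proj₁; proj₂; ∃; map₁; uncurry)
open import Data.Product.Function.NonDependent.Propositional using (_×-⇔_)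
open import Function using (_∘_; id)
open import Function.Bundles using (_⇔_; mk⇔; Equivalence)
open import Function.Definitions using (Injective)
open import Function.Related.Propositional using (SK-sym; module EquationalReasoning)
open import Relation.Binary.PropositionalEquality
  using (_≡_; refl; sym; trans; cong; cong₂; module ≡-Reasoning)

private
  variable
    m n : ℕ

sum-tabulate : (f : Fin n → ℕ) → List.sum (List.tabulate f) ≡ sum f
sum-tabulate {zero}  f = refl
sum-tabulate {suc n} f = cong (f zero +_) (sum-tabulate (f ∘ suc))

sum-↑ : ∀ m {n} (f : Fin (m + n) → ℕ) → sum f ≡ sum (f ∘ (_↑ˡ n)) + sum (f ∘ (m ↑ʳ_))
sum-↑ zero    f = refl
sum-↑ (suc m) {n} f = trans (cong (f zero +_) (sum-↑ m (f ∘ suc)))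
  (sym (+-assoc (f zero) (sum (f ∘ suc ∘ (_↑ˡ n))) (sum (f ∘ suc ∘ (m ↑ʳ_)))))

remQuot-↑ʳ : ∀ m n (i : Fin (m * n)) → remQuot {suc m} n (n ↑ʳ i) ≡ map₁ suc (remQuot {m} n i)
remQuot-↑ʳ m n i rewrite splitAt-↑ʳ n (m * n) i = refl

sum-remQuot : ∀ m n (f : Fin m → Fin n → ℕ) →
              sum (uncurry f ∘ remQuot {m} n) ≡ ∑[ i < m ] ∑[ j < n ] f i j
sum-remQuot zero    n f = refl
sum-remQuot (suc m) n f = begin
  sum (uncurry f ∘ remQuot n)
    ≡⟨ sum-↑ n (uncurry f ∘ remQuot n) ⟩
  sum (uncurry f ∘ remQuot n ∘ (_↑ˡ m * n)) + sum (uncurry f ∘ remQuot n ∘ (n ↑ʳ_))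
    ≡⟨ cong₂ _+_ (sum-cong-≗ (cong (uncurry f) ∘ remQuot-combine zero))
                 (sum-cong-≗ (cong (uncurry f) ∘ remQuot-↑ʳ m n)) ⟩
  ∑[ j < n ] f zero j + sum (uncurry (f ∘ suc) ∘ remQuot n)
    ≡⟨ cong (∑[ j < n ] f zero j +_) (sum-remQuot m n (f ∘ suc)) ⟩
  ∑[ i < suc m ] ∑[ j < n ] f i j ∎
  where open ≡-Reasoning

sum-*-sum : (f : Fin m → ℕ) (g : Fin n → ℕ) → ∑[ i < m ] ∑[ j < n ] (f i * g j) ≡ sum f * sum g
sum-*-sum f g = trans (sum-cong-≗ (λ i → sym (*-distribˡ-sum (f i) g)))
                      (sym (*-distribʳ-sum (sum g) f))

toℕ : Bool → ℕ
toℕ true  = 1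
toℕ false = 0

toℕ-∧ : ∀ a b → toℕ (a ∧ b) ≡ toℕ a * toℕ b
toℕ-∧ true  true  = refl
toℕ-∧ true  false = refl
toℕ-∧ false b     = refl

∧-≡-true : ∀ {a b} → (a ∧ b ≡ true) ⇔ (a ≡ true × b ≡ true)
∧-≡-true {true}  = mk⇔ (refl ,_) proj₂
∧-≡-true {false} = mk⇔ (λ ()) (λ ())

-- The indicator Bool → ℕ used by count is local to Defs, so it is recovered by unification.
count≡sum : ∀ n (p : Fin n → Bool) → count n p ≡ ∑[ w < n ] toℕ (p w)
count≡sum n p = begin
  count n p                                        ≡⟨ count-unfold ⟩
  List.sum (List.map indicator (List.allFin n))    ≡⟨ cong List.sum (map-tabulate id indicator) ⟩
  List.sum (List.tabulate indicator)               ≡⟨ sum-tabulate indicator ⟩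
  sum indicator                                    ≡⟨ sum-cong-≗ indicator≗toℕ ⟩
  ∑[ w < n ] toℕ (p w)                             ∎
  where
  open ≡-Reasoning
  indicator : Fin n → ℕ
  indicator = _
  count-unfold : count n p ≡ List.sum (List.map indicator (List.allFin n))
  count-unfold = refl
  indicator≗toℕ : ∀ w → indicator w ≡ toℕ (p w)
  indicator≗toℕ w with p w
  ... | true  = refl
  ... | false = refl

count-cong : {p q : Fin n → Bool} → (∀ w → p w ≡ q w) → count n p ≡ count n q
count-cong {n} {p} {q} p≗q =
  trans (count≡sum n p) (trans (sum-cong-≗ (cong toℕ ∘ p≗q)) (sym (count≡sum n q)))

count-× : ∀ n₁ n₂ (p : Fin n₁ → Bool) (q : Fin n₂ → Bool) →
          count (n₁ * n₂) (λ w → p (fst n₁ n₂ w) ∧ q (snd n₁ n₂ w)) ≡ count n₁ p * count n₂ q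
count-× n₁ n₂ p q = begin
  count (n₁ * n₂) (λ w → p (fst n₁ n₂ w) ∧ q (snd n₁ n₂ w))
    ≡⟨ count≡sum (n₁ * n₂) _ ⟩
  sum (λ w → toℕ (p (fst n₁ n₂ w) ∧ q (snd n₁ n₂ w)))
    ≡⟨ sum-remQuot n₁ n₂ (λ i j → toℕ (p i ∧ q j)) ⟩
  ∑[ i < n₁ ] ∑[ j < n₂ ] toℕ (p i ∧ q j)
    ≡⟨ sum-cong-≗ (λ i → sum-cong-≗ (λ j → toℕ-∧ (p i) (q j))) ⟩
  ∑[ i < n₁ ] ∑[ j < n₂ ] (toℕ (p i) * toℕ (q j))
    ≡⟨ sum-*-sum (toℕ ∘ p) (toℕ ∘ q) ⟩
  sum (toℕ ∘ p) * sum (toℕ ∘ q)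
    ≡⟨ sym (cong₂ _*_ (count≡sum n₁ p) (count≡sum n₂ q)) ⟩
  count n₁ p * count n₂ q ∎
  where open ≡-Reasoning

fst-combine : ∀ {n₁ n₂} (i : Fin n₁) (j : Fin n₂) → fst n₁ n₂ (combine i j) ≡ i
fst-combine i j = cong proj₁ (remQuot-combine i j)

snd-combine : ∀ {n₁ n₂} (i : Fin n₁) (j : Fin n₂) → snd n₁ n₂ (combine i j) ≡ j
snd-combine i j = cong proj₂ (remQuot-combine i j)

combine-fst-snd : ∀ n₁ n₂ (x : Fin (n₁ * n₂)) → combine (fst n₁ n₂ x) (snd n₁ n₂ x) ≡ x
combine-fst-snd n₁ n₂ = combine-remQuot {n₁} n₂

pairMap : ∀ {m₁ m₂ n₁ n₂} → (Fin m₁ → Fin n₁) → (Fin m₂ → Fin n₂) → Fin (m₁ * m₂) → Fin (n₁ * n₂)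
pairMap {m₁} {m₂} f₁ f₂ i = combine (f₁ (fst m₁ m₂ i)) (f₂ (snd m₁ m₂ i))

module _ {m₁ m₂ n₁ n₂} {f₁ : Fin m₁ → Fin n₁} {f₂ : Fin m₂ → Fin n₂} where

  pairMap-injective : Injective _≡_ _≡_ f₁ → Injective _≡_ _≡_ f₂ → Injective _≡_ _≡_ (pairMap f₁ f₂)
  pairMap-injective f₁-inj f₂-inj {i} {j} eq
    with combine-injective (f₁ (fst m₁ m₂ i)) (f₂ (snd m₁ m₂ i)) (f₁ (fst m₁ m₂ j)) (f₂ (snd m₁ m₂ j)) eq
  ... | e₁ , e₂ = begin
    i                                     ≡⟨ combine-fst-snd m₁ m₂ i ⟨
    combine (fst m₁ m₂ i) (snd m₁ m₂ i)   ≡⟨ cong₂ combine (f₁-inj e₁) (f₂-inj e₂) ⟩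
    combine (fst m₁ m₂ j) (snd m₁ m₂ j)   ≡⟨ combine-fst-snd m₁ m₂ j ⟩
    j                                     ∎
    where open ≡-Reasoning

  pairMap-image : ∀ w → (∃ λ i → pairMap f₁ f₂ i ≡ w) ⇔
                        ((∃ λ i₁ → f₁ i₁ ≡ fst n₁ n₂ w) × (∃ λ i₂ → f₂ i₂ ≡ snd n₁ n₂ w))
  pairMap-image w = mk⇔ to from
    where
    to : (∃ λ i → pairMap f₁ f₂ i ≡ w) → (∃ λ i₁ → f₁ i₁ ≡ fst n₁ n₂ w) × (∃ λ i₂ → f₂ i₂ ≡ snd n₁ n₂ w)
    to (i , refl) = (fst m₁ m₂ i , sym (fst-combine (f₁ (fst m₁ m₂ i)) (f₂ (snd m₁ m₂ i))))
                  , (snd m₁ m₂ i , sym (snd-combine (f₁ (fst m₁ m₂ i)) (f₂ (snd m₁ m₂ i))))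
    from : (∃ λ i₁ → f₁ i₁ ≡ fst n₁ n₂ w) × (∃ λ i₂ → f₂ i₂ ≡ snd n₁ n₂ w) → ∃ λ i → pairMap f₁ f₂ i ≡ w
    from ((i₁ , e₁) , (i₂ , e₂)) = combine i₁ i₂ , (begin
      pairMap f₁ f₂ (combine i₁ i₂)
        ≡⟨ cong₂ combine (cong f₁ (fst-combine i₁ i₂)) (cong f₂ (snd-combine i₁ i₂)) ⟩
      combine (f₁ i₁) (f₂ i₂)               ≡⟨ cong₂ combine e₁ e₂ ⟩
      combine (fst n₁ n₂ w) (snd n₁ n₂ w)   ≡⟨ combine-fst-snd n₁ n₂ w ⟩
      w                                     ∎)
      where open ≡-Reasoning

common : Graph n → Fin n → Fin n → Fin n → Bool
common G u v w = adj G u w ∧ adj G v w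

module _ {n₁ n₂} (G₁ : Graph n₁) (G₂ : Graph n₂) where

  private
    π₁ : Fin (n₁ * n₂) → Fin n₁
    π₁ = fst n₁ n₂
    π₂ : Fin (n₁ * n₂) → Fin n₂
    π₂ = snd n₁ n₂

  ⊗-adjacent : ∀ {x y} → x ~ y within (G₁ ⊗ G₂) → π₁ x ~ π₁ y within G₁ × π₂ x ~ π₂ y within G₂
  ⊗-adjacent = Equivalence.to ∧-≡-true

  common-⊗ : ∀ x y w → common (G₁ ⊗ G₂) x y w
                       ≡ common G₁ (π₁ x) (π₁ y) (π₁ w) ∧ common G₂ (π₂ x) (π₂ y) (π₂ w)
  common-⊗ x y w = interchange (adj G₁ (π₁ x) (π₁ w)) (adj G₂ (π₂ x) (π₂ w))
                               (adj G₁ (π₁ y) (π₁ w)) (adj G₂ (π₂ y) (π₂ w))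

  degree-⊗ : ∀ x → degree (G₁ ⊗ G₂) x ≡ degree G₁ (π₁ x) * degree G₂ (π₂ x)
  degree-⊗ x = count-× n₁ n₂ (adj G₁ (π₁ x)) (adj G₂ (π₂ x))

  commonCount-⊗ : ∀ x y → commonCount (G₁ ⊗ G₂) x y
                          ≡ commonCount G₁ (π₁ x) (π₁ y) * commonCount G₂ (π₂ x) (π₂ y)
  commonCount-⊗ x y = trans (count-cong (common-⊗ x y))
                            (count-× n₁ n₂ (common G₁ (π₁ x) (π₁ y)) (common G₂ (π₂ x) (π₂ y)))

  ER-⊗ : ∀ {d₁ l₁ d₂ l₂} → ER n₁ d₁ l₁ G₁ → ER n₂ d₂ l₂ G₂ → ER (n₁ * n₂) (d₁ * d₂) (l₁ * l₂) (G₁ ⊗ G₂)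
  ER-⊗ (deg₁ , com₁) (deg₂ , com₂) =
    (λ x → trans (degree-⊗ x) (cong₂ _*_ (deg₁ (π₁ x)) (deg₂ (π₂ x)))) ,
    (λ x y x~y → let (x₁~y₁ , x₂~y₂) = ⊗-adjacent x~y in
      trans (commonCount-⊗ x y) (cong₂ _*_ (com₁ _ _ x₁~y₁) (com₂ _ _ x₂~y₂)))

  adj-⊗-combine : ∀ a b c d → adj (G₁ ⊗ G₂) (combine a b) (combine c d) ≡ adj G₁ a c ∧ adj G₂ b d
  adj-⊗-combine a b c d = cong₂ _∧_ (cong₂ (adj G₁) (fst-combine a b) (fst-combine c d))
                                    (cong₂ (adj G₂) (snd-combine a b) (snd-combine c d))

  InducedCommonIso-⊗ : ∀ {m₁ m₂} {H₁ : Graph m₁} {H₂ : Graph m₂} x y →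
                       InducedCommonIso G₁ (π₁ x) (π₁ y) H₁ → InducedCommonIso G₂ (π₂ x) (π₂ y) H₂ →
                       InducedCommonIso (G₁ ⊗ G₂) x y (H₁ ⊗ H₂)
  InducedCommonIso-⊗ {m₁} {m₂} {H₁} {H₂} x y (f₁ , f₁-inj , image₁ , hom₁) (f₂ , f₂-inj , image₂ , hom₂) =
    pairMap f₁ f₂ , pairMap-injective f₁-inj f₂-inj , image , hom
    where
    image : ∀ w → (common (G₁ ⊗ G₂) x y w ≡ true) ⇔ (∃ λ i → pairMap f₁ f₂ i ≡ w)
    image w = begin
      common (G₁ ⊗ G₂) x y w ≡ true
        ≡⟨ cong (_≡ true) (common-⊗ x y w) ⟩
      common G₁ (π₁ x) (π₁ y) (π₁ w) ∧ common G₂ (π₂ x) (π₂ y) (π₂ w) ≡ true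
        ∼⟨ ∧-≡-true ⟩
      (common G₁ (π₁ x) (π₁ y) (π₁ w) ≡ true × common G₂ (π₂ x) (π₂ y) (π₂ w) ≡ true)
        ∼⟨ image₁ (π₁ w) ×-⇔ image₂ (π₂ w) ⟩
      ((∃ λ i₁ → f₁ i₁ ≡ π₁ w) × (∃ λ i₂ → f₂ i₂ ≡ π₂ w))
        ∼⟨ SK-sym (pairMap-image w) ⟩
      (∃ λ i → pairMap f₁ f₂ i ≡ w) ∎
      where open EquationalReasoning
    hom : ∀ i j → adj (H₁ ⊗ H₂) i j ≡ adj (G₁ ⊗ G₂) (pairMap f₁ f₂ i) (pairMap f₁ f₂ j)
    hom i j = trans (cong₂ _∧_ (hom₁ (fst m₁ m₂ i) (fst m₁ m₂ j)) (hom₂ (snd m₁ m₂ i) (snd m₁ m₂ j)))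
                    (sym (adj-⊗-combine _ _ _ _))

  UniformSNS-⊗ : ∀ {m₁ m₂} {H₁ : Graph m₁} {H₂ : Graph m₂} →
                 UniformSNS G₁ H₁ → UniformSNS G₂ H₂ → UniformSNS (G₁ ⊗ G₂) (H₁ ⊗ H₂)
  UniformSNS-⊗ {H₁ = H₁} {H₂} sns₁ sns₂ x y x~y = let (x₁~y₁ , x₂~y₂) = ⊗-adjacent x~y in
    InducedCommonIso-⊗ {H₁ = H₁} {H₂} x y (sns₁ _ _ x₁~y₁) (sns₂ _ _ x₂~y₂)

theorem8 : ∀ {n₁ d₁ l₁ n₂ d₂ l₂ m₁ m₂ : ℕ}
           (G₁ : Graph n₁) (G₂ : Graph n₂) (H₁ : Graph m₁) (H₂ : Graph m₂) →
           ER n₁ d₁ l₁ G₁ → UniformSNS G₁ H₁ →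
           ER n₂ d₂ l₂ G₂ → UniformSNS G₂ H₂ →
           ER (n₁ * n₂) (d₁ * d₂) (l₁ * l₂) (G₁ ⊗ G₂) × UniformSNS (G₁ ⊗ G₂) (H₁ ⊗ H₂)
theorem8 {d₁ = d₁} {l₁} {d₂ = d₂} {l₂} G₁ G₂ H₁ H₂ er₁ sns₁ er₂ sns₂ =
  ER-⊗ G₁ G₂ {d₁} {l₁} {d₂} {l₂} er₁ er₂ , UniformSNS-⊗ G₁ G₂ {H₁ = H₁} {H₂ = H₂} sns₁ sns₂
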